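{- Let $q\ge2$ and $n\ge1$ be integers. Under each of the scenarios $(**)$, $(*\bullet)$, and $(\bullet\bullet)$, the family $\mathcal{N}_q=\{x\mapsto[\![x\ne t]\!]\}_{t\in[q\rangle}$ is $n$-cell implementable if and only if $q\le 2n$.
   Context: $[b\rangle=\{0,1,\ldots,b-1\}$. Let $\mathbb{B}=\{0,1\}$, $\mathbb{B}_\circ=\mathbb{B}$, $\mathbb{B}_*=\mathbb{B}\cup\{*\}$, $\mathbb{B}_\bullet=\mathbb{B}\cup\{*,\bullet\}$. Define $\mathrm{T}:\mathbb{B}_\bullet^2\to\mathbb{B}$ by $\mathrm{T}(u,\vartheta)=1$ if and only if $u=*$, or $\vartheta=*$, or $u=\vartheta\in\mathbb{B}$. $[\![\cdot]\!]$ is the Iverson bracket. $\mathcal{F}_q$ is the set of all functions $[q\rangle\to\mathbb{B}$. For $\alpha,\beta\in\{\circ,*,\bullet\}$, a subset $\Phi\subseteq\mathcal{F}_q$ is $n$-cell implementable under scenario $(\alpha\beta)$ if there exist mappings $\mathbf{u}=(u_j)_{j\in[n\rangle}:[q\rangle\to\mathbb{B}_\alpha^n$ and $\boldsymbol{\vartheta}=(\vartheta_j)_{j\in[n\rangle}:\Phi\to\mathbb{B}_\beta^n$ such that $f(x)=\bigwedge_{j\in[n\rangle}\mathrm{T}(u_j(x),\vartheta_j(f))$ for all $f\in\Phi$ and $x\in[q\rangle$. -}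

module Defs where

open import Data.Nat using (ℕ)
open import Data.Fin using (Fin)
open import Data.Fin.Properties using (_≟_)
open import Data.Bool using (Bool; true; false; _∧_; not)
open import Data.Vec.Functional using (Vector; foldr)
open import Relation.Nullary.Decidable using (⌊_⌋)

data B• : Set where
  b0 b1 ⋆ • : B•

data Scen : Set where
  ∘ₛ ⋆ₛ •ₛ : Scen

data InAlph : Scen → B• → Set where
  ∘-0 : InAlph ∘ₛ b0
  ∘-1 : InAlph ∘ₛ b1
  ⋆-0 : InAlph ⋆ₛ b0
  ⋆-1 : InAlph ⋆ₛ b1
  ⋆-⋆ : InAlph ⋆ₛ ⋆
  •-0 : InAlph •ₛ b0
  •-1 : InAlph •ₛ b1
  •-⋆ : InAlph •ₛ ⋆
  •-• : InAlph •ₛ •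

T : B• → B• → Bool
T ⋆ _ = true
T _ ⋆ = true
T b0 b0 = true
T b1 b1 = true
T _ _ = false

⋀ : ∀ {n} → Vector Bool n → Bool
⋀ = foldr _∧_ true

-- n-cell implementability under scenario (αβ) of a family Φ ⊆ 𝓕_q,
-- given as a family of functions indexed by a type I (ϑ is defined on the members).
Implementable : (α β : Scen) (q n : ℕ) {I : Set} → (I → (Fin q → Bool)) → Set
Implementable α β q n {I} Φ =
  Σ (Fin q → Fin n → B•) λ u →
  Σ (I → Fin n → B•) λ ϑ →
    (∀ x j → InAlph α (u x j)) ×
    (∀ i j → InAlph β (ϑ i j)) ×
    (∀ i x → Φ i x ≡ ⋀ (λ j → T (u x j) (ϑ i j)))
  where
  open import Data.Product using (Σ; _×_)
  open import Relation.Binary.PropositionalEquality using (_≡_)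

𝒩 : (q : ℕ) → Fin q → (Fin q → Bool)
𝒩 q t x = not ⌊ x ≟ t ⌋

{-# OPTIONS --safe #-}
module Submission where

-- Each t needs a cell j where u t j and ϑ t j clash. If distinct s and t clashed in
-- the same cell j, each would pass the other's key there, which forces u s j and u t j
-- to be distinct bits; so t ↦ (the bit u t j, j) injects [q⟩ into 𝔹 × [n⟩. Conversely,
-- an injection x ↦ (b, k) is realised by putting b in cell k of u x, the complement
-- of b in cell k of ϑ x, and * everywhere else.

open import Defs
open import Data.Nat using (ℕ; _≤_; _*_; zero; suc)
open import Data.Fin using (Fin; opposite) renaming (zero to fz; suc to fs)
open import Data.Fin.Properties using (_≟_; inject≤-injective; injective⇒≤; *↔×)
open import Data.Bool using (Bool; true; false)
open import Data.Product using (_×_; ∃; _,_; proj₁; proj₂)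
open import Data.Sum using (_⊎_; inj₁; inj₂)
open import Data.Empty using (⊥-elim)
open import Function using (_∘_)
open import Function.Bundles using (_⇔_; mk⇔; _↣_; mk↣; Injection)
open import Function.Properties.Inverse using (↔⇒↣; ↔-sym)
open import Function.Properties.Injection using (↣-trans)
open import Relation.Nullary using (yes; no)
open import Relation.Binary.PropositionalEquality using (_≡_; _≢_; refl; sym; trans; cong; cong₂)

⋀-true⁻ : ∀ {n} (v : Fin n → Bool) → ⋀ v ≡ true → ∀ j → v j ≡ true
⋀-true⁻ v eq fz with v fz
... | true = refl
⋀-true⁻ v eq (fs j) with v fz
... | true = ⋀-true⁻ (v ∘ fs) eq j

⋀-true⁺ : ∀ {n} (v : Fin n → Bool) → (∀ j → v j ≡ true) → ⋀ v ≡ true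
⋀-true⁺ {zero} v all = refl
⋀-true⁺ {suc n} v all with v fz | all fz
... | true | refl = ⋀-true⁺ (v ∘ fs) (all ∘ fs)

⋀-false⁻ : ∀ {n} (v : Fin n → Bool) → ⋀ v ≡ false → ∃ λ j → v j ≡ false
⋀-false⁻ {suc n} v eq with v fz in v0
... | false = fz , v0
... | true with ⋀-false⁻ (v ∘ fs) eq
...   | j , vj = fs j , vj

⋀-false⁺ : ∀ {n} (v : Fin n → Bool) j → v j ≡ false → ⋀ v ≡ false
⋀-false⁺ v j vj with ⋀ v in eq
... | false = refl
... | true with () ← trans (sym vj) (⋀-true⁻ v eq j)

bitIndex : B• → Fin 2
bitIndex b1 = fs fz
bitIndex _  = fz

bitIndex-injective : ∀ {a c} → InAlph ∘ₛ a → InAlph ∘ₛ c → bitIndex a ≡ bitIndex c → a ≡ c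
bitIndex-injective ∘-0 ∘-0 _ = refl
bitIndex-injective ∘-1 ∘-1 _ = refl

T-false-true-false⇒bit : ∀ {a b c d} → T a b ≡ false → T a d ≡ true → T c d ≡ false → InAlph ∘ₛ a
T-false-true-false⇒bit {b0} _ _ _ = ∘-0
T-false-true-false⇒bit {b1} _ _ _ = ∘-1
T-false-true-false⇒bit {•} {d = b0} _ () _
T-false-true-false⇒bit {•} {d = b1} _ () _
T-false-true-false⇒bit {•} {c = b0} {d = ⋆} _ _ ()
T-false-true-false⇒bit {•} {c = b1} {d = ⋆} _ _ ()
T-false-true-false⇒bit {•} {c = ⋆} {d = ⋆} _ _ ()
T-false-true-false⇒bit {•} {c = •} {d = ⋆} _ _ ()
T-false-true-false⇒bit {•} {d = •} _ () _

crossing⇒bitIndex≢ : ∀ {a b c d} → T a b ≡ false → T c d ≡ false → T a d ≡ true → T c b ≡ true →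
                     bitIndex a ≢ bitIndex c
crossing⇒bitIndex≢ ab cd ad cb same
  with refl ← bitIndex-injective (T-false-true-false⇒bit ab ad cd) (T-false-true-false⇒bit cd cb ab) same
  with () ← trans (sym ab) cb

𝒩-diagonal : ∀ {q} (t : Fin q) → 𝒩 q t t ≡ false
𝒩-diagonal t with t ≟ t
... | yes _ = refl
... | no t≢t = ⊥-elim (t≢t refl)

𝒩-off-diagonal : ∀ {q} {t x : Fin q} → x ≢ t → 𝒩 q t x ≡ true
𝒩-off-diagonal {t = t} {x} x≢t with x ≟ t
... | yes x≡t = ⊥-elim (x≢t x≡t)
... | no _ = refl

module Necessity {q n} (u ϑ : Fin q → Fin n → B•)
                 (implements : ∀ t x → 𝒩 q t x ≡ ⋀ (λ j → T (u x j) (ϑ t j))) where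

  blocking : ∀ t → ∃ λ j → T (u t j) (ϑ t j) ≡ false
  blocking t = ⋀-false⁻ _ (trans (sym (implements t t)) (𝒩-diagonal t))

  passing : ∀ {t x} → x ≢ t → ∀ j → T (u x j) (ϑ t j) ≡ true
  passing {t} {x} x≢t = ⋀-true⁻ _ (trans (sym (implements t x)) (𝒩-off-diagonal x≢t))

  encode : Fin q → Fin 2 × Fin n
  encode t = bitIndex (u t (proj₁ (blocking t))) , proj₁ (blocking t)

  encode-injective : ∀ {s t} → encode s ≡ encode t → s ≡ t
  encode-injective {s} {t} eq with s ≟ t
  ... | yes s≡t = s≡t
  ... | no s≢t with blocking s | blocking t | eq
  ...   | j , sj | _ , tj | codes≡ with refl ← cong proj₂ codes≡ = ⊥-elim
    (crossing⇒bitIndex≢ sj tj (passing s≢t j) (passing (s≢t ∘ sym) j) (cong proj₁ codes≡))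

  ↣-cells : Fin q ↣ (Fin 2 × Fin n)
  ↣-cells = mk↣ encode-injective

implementable⇒↣ : ∀ {α β q n} → Implementable α β q n (𝒩 q) → Fin q ↣ (Fin 2 × Fin n)
implementable⇒↣ (u , ϑ , _ , _ , implements) = Necessity.↣-cells u ϑ implements

↣×⇒≤ : ∀ {q m n} → Fin q ↣ (Fin m × Fin n) → q ≤ m * n
↣×⇒≤ f = injective⇒≤ (Injection.injective (↣-trans f (↔⇒↣ (↔-sym *↔×))))

≤⇒↣× : ∀ {q m n} → q ≤ m * n → Fin q ↣ (Fin m × Fin n)
≤⇒↣× q≤mn = ↣-trans (mk↣ (inject≤-injective q≤mn q≤mn _ _)) (↔⇒↣ *↔×)

bit : Fin 2 → B•
bit fz = b0
bit (fs fz) = b1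

bit∈𝔹* : ∀ b → InAlph ⋆ₛ (bit b)
bit∈𝔹* fz = ⋆-0
bit∈𝔹* (fs fz) = ⋆-1

T-bit-opposite : ∀ b → T (bit b) (bit (opposite b)) ≡ false
T-bit-opposite fz = refl
T-bit-opposite (fs fz) = refl

T-bit-opposite-≢ : ∀ {b c} → b ≢ c → T (bit b) (bit (opposite c)) ≡ true
T-bit-opposite-≢ {fz} {fz} b≢c = ⊥-elim (b≢c refl)
T-bit-opposite-≢ {fz} {fs fz} _ = refl
T-bit-opposite-≢ {fs fz} {fz} _ = refl
T-bit-opposite-≢ {fs fz} {fs fz} b≢c = ⊥-elim (b≢c refl)

T-⋆ʳ : ∀ a → T a ⋆ ≡ true
T-⋆ʳ b0 = refl
T-⋆ʳ b1 = refl
T-⋆ʳ ⋆ = refl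
T-⋆ʳ • = refl

placeAt : ∀ {n} → Fin n → B• → Fin n → B•
placeAt k v j with j ≟ k
... | yes _ = v
... | no _ = ⋆

placeAt∈𝔹* : ∀ {n} (k : Fin n) {v} → InAlph ⋆ₛ v → ∀ j → InAlph ⋆ₛ (placeAt k v j)
placeAt∈𝔹* k v∈ j with j ≟ k
... | yes _ = v∈
... | no _ = ⋆-⋆

placeAt-here : ∀ {n} (k : Fin n) v → placeAt k v k ≡ v
placeAt-here k v with k ≟ k
... | yes _ = refl
... | no k≢k = ⊥-elim (k≢k refl)

module Sufficiency {q n} (f : Fin q ↣ (Fin 2 × Fin n)) where

  open Injection f using (to; injective)

  u ϑ : Fin q → Fin n → B•
  u x = placeAt (proj₂ (to x)) (bit (proj₁ (to x)))
  ϑ t = placeAt (proj₂ (to t)) (bit (opposite (proj₁ (to t))))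

  blocks : ∀ t → T (u t (proj₂ (to t))) (ϑ t (proj₂ (to t))) ≡ false
  blocks t rewrite placeAt-here (proj₂ (to t)) (bit (proj₁ (to t)))
                 | placeAt-here (proj₂ (to t)) (bit (opposite (proj₁ (to t))))
                 = T-bit-opposite (proj₁ (to t))

  passes : ∀ {t x} → x ≢ t → ∀ j → T (u x j) (ϑ t j) ≡ true
  passes {t} {x} x≢t j with j ≟ proj₂ (to x) | j ≟ proj₂ (to t)
  ... | no _ | _ = refl
  ... | yes _ | no _ = T-⋆ʳ (bit (proj₁ (to x)))
  ... | yes refl | yes k≡ = T-bit-opposite-≢ λ b≡ → x≢t (injective (cong₂ _,_ b≡ k≡))

  implements : ∀ t x → 𝒩 q t x ≡ ⋀ (λ j → T (u x j) (ϑ t j))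
  implements t x with x ≟ t
  ... | yes refl = sym (⋀-false⁺ (λ j → T (u x j) (ϑ x j)) _ (blocks x))
  ... | no x≢t = sym (⋀-true⁺ _ (passes x≢t))

  implementable : Implementable ⋆ₛ ⋆ₛ q n (𝒩 q)
  implementable = u , ϑ , (λ x → placeAt∈𝔹* _ (bit∈𝔹* _)) , (λ t → placeAt∈𝔹* _ (bit∈𝔹* _)) , implements

_⊑_ : Scen → Scen → Set
α ⊑ β = ∀ {v} → InAlph α v → InAlph β v

⊑-refl : ∀ {α} → α ⊑ α
⊑-refl v∈ = v∈

⋆ₛ⊑•ₛ : ⋆ₛ ⊑ •ₛ
⋆ₛ⊑•ₛ ⋆-0 = •-0
⋆ₛ⊑•ₛ ⋆-1 = •-1
⋆ₛ⊑•ₛ ⋆-⋆ = •-⋆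

implementable-mono : ∀ {α α′ β β′ q n I} {Φ : I → Fin q → Bool} → α ⊑ α′ → β ⊑ β′ →
                     Implementable α β q n Φ → Implementable α′ β′ q n Φ
implementable-mono α⊑ β⊑ (u , ϑ , u∈ , ϑ∈ , implements) =
  u , ϑ , (λ x j → α⊑ (u∈ x j)) , (λ i j → β⊑ (ϑ∈ i j)) , implements

scenario⇒⋆ₛ⊑ : ∀ {α β} → (α ≡ ⋆ₛ × β ≡ ⋆ₛ) ⊎ (α ≡ ⋆ₛ × β ≡ •ₛ) ⊎ (α ≡ •ₛ × β ≡ •ₛ) →
               ⋆ₛ ⊑ α × ⋆ₛ ⊑ β
scenario⇒⋆ₛ⊑ (inj₁ (refl , refl)) = ⊑-refl , ⊑-refl
scenario⇒⋆ₛ⊑ (inj₂ (inj₁ (refl , refl))) = ⊑-refl , ⋆ₛ⊑•ₛ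
scenario⇒⋆ₛ⊑ (inj₂ (inj₂ (refl , refl))) = ⋆ₛ⊑•ₛ , ⋆ₛ⊑•ₛ

proposition7 : (q n : ℕ) → 2 ≤ q → 1 ≤ n →
    (α β : Scen) →
    ((α ≡ ⋆ₛ × β ≡ ⋆ₛ) ⊎ (α ≡ ⋆ₛ × β ≡ •ₛ) ⊎ (α ≡ •ₛ × β ≡ •ₛ)) →
    (Implementable α β q n (𝒩 q) ⇔ q ≤ 2 * n)
proposition7 q n _ _ α β scenario =
  let ⋆ₛ⊑α , ⋆ₛ⊑β = scenario⇒⋆ₛ⊑ scenario in
  mk⇔ (↣×⇒≤ ∘ implementable⇒↣)
      (implementable-mono ⋆ₛ⊑α ⋆ₛ⊑β ∘ Sufficiency.implementable ∘ ≤⇒↣×)
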